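{- Let $G=\mathcal{K}_7$ be the complete graph on seven vertices. There exists a subset $\boldsymbol{u}$ of $\mathcal{C}(G)$ which is a minimal neighborhood of $G$ (viewed as an element of $\mathcal{C}(G)$), which is regular open, which satisfies $X\in\boldsymbol{u}\Leftrightarrow G\setminus X\notin\boldsymbol{u}$ for every $X\subseteq G$, and which contains three elements $Q_0,Q_1,Q_2$ such that $G$ is the disjoint union $Q_0\cup Q_1\cup Q_2$. In particular, $\boldsymbol{u}$ contains no clopen neighborhood of $G$.
   Context: For a graph $G$, $\mathcal{C}(G)$ is the set of nonempty connected subsets of $G$ (for $\mathcal{K}_7$, all nonempty vertex subsets). For $\boldsymbol{x}\subseteq\mathcal{C}(G)$, $\varphi(\boldsymbol{x})$ is the set of $X\in\mathcal{C}(G)$ that are the disjoint union of some nonempty finite subset of $\boldsymbol{x}$; $\check\varphi(\boldsymbol{x})=\mathcal{C}(G)\setminus\varphi(\mathcal{C}(G)\setminus\boldsymbol{x})$. A set is open if $\check\varphi(\boldsymbol{x})=\boldsymbol{x}$, clopen if also $\varphi(\boldsymbol{x})=\boldsymbol{x}$, regular open if $\boldsymbol{x}=\check\varphi\varphi(\boldsymbol{x})$. A neighborhood of $p\in\mathcal{C}(G)$ is a set $\boldsymbol{u}$ with $p\in\check\varphi(\boldsymbol{u})$; a minimal neighborhood is one minimal under inclusion among neighborhoods of $p$. -}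

module Defs where

open import Data.Nat using (ℕ)
open import Data.Bool using (Bool; true; false)
open import Data.Fin.Subset using (Subset; ⊤; ⊥; _∪_; _∩_; ∁; ⋃; Nonempty; Empty)
open import Data.List using (List; []; _∷_)
open import Data.List.Relation.Unary.All using (All)
open import Data.List.Relation.Unary.AllPairs using (AllPairs)
open import Data.Product using (Σ; _×_; ∃)
open import Relation.Nullary using (¬_)
open import Relation.Binary.PropositionalEquality using (_≡_)

-- The complete graph 𝒦ₙ has vertex set Fin n; every nonempty vertex subset
-- is connected, so 𝒞(𝒦ₙ) = nonempty subsets of Fin n.
-- A subset 𝒙 ⊆ 𝒞(𝒦ₙ) is represented by a predicate on Subset n; an X is a
-- member of 𝒙 iff X is nonempty (X ∈ 𝒞(G)) and 𝒙 X holds.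
Fam : ℕ → Set₁
Fam n = Subset n → Set

⟦_⟧ : ∀ {n} → (Subset n → Bool) → Fam n
⟦ b ⟧ X = b X ≡ true

_∈ᶜ_ : ∀ {n} → Subset n → Fam n → Set
X ∈ᶜ x = Nonempty X × x X

_∉ᶜ_ : ∀ {n} → Subset n → Fam n → Set
X ∉ᶜ x = ¬ (X ∈ᶜ x)

_⊆ᶜ_ : ∀ {n} → Fam n → Fam n → Set
x ⊆ᶜ y = ∀ X → X ∈ᶜ x → X ∈ᶜ y

_≐ᶜ_ : ∀ {n} → Fam n → Fam n → Set
x ≐ᶜ y = x ⊆ᶜ y × y ⊆ᶜ x

Disjoint : ∀ {n} → Subset n → Subset n → Set
Disjoint p q = Empty (p ∩ q)

compl : ∀ {n} → Fam n → Fam n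
compl x X = ¬ (X ∈ᶜ x)

-- φ(𝒙): X ∈ 𝒞(G) that is the disjoint union of a nonempty finite
-- subfamily of 𝒙 (given as a nonempty list of pairwise disjoint members;
-- members are nonempty, so pairwise disjoint entries are distinct).
φ : ∀ {n} → Fam n → Fam n
φ x X = Σ (List (Subset _)) λ L →
          ¬ (L ≡ []) × All (λ Y → Y ∈ᶜ x) L × AllPairs Disjoint L × ⋃ L ≡ X

φ̌ : ∀ {n} → Fam n → Fam n
φ̌ x = compl (φ (compl x))

IsOpen : ∀ {n} → Fam n → Set
IsOpen x = φ̌ x ≐ᶜ x

IsClopen : ∀ {n} → Fam n → Set
IsClopen x = IsOpen x × φ x ≐ᶜ x

IsRegularOpen : ∀ {n} → Fam n → Set
IsRegularOpen x = x ≐ᶜ φ̌ (φ x)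

IsNbhd : ∀ {n} → Subset n → Fam n → Set
IsNbhd p u = p ∈ᶜ φ̌ u

-- minimal neighborhood: minimal under inclusion among neighborhoods of p.
-- Competitors range over (decidable) subsets of the finite set 𝒞(𝒦ₙ).
IsMinNbhd : ∀ {n} → Subset n → Fam n → Set
IsMinNbhd {n} p u = IsNbhd p u ×
  ((v : Subset n → Bool) → ⟦ v ⟧ ⊆ᶜ u → IsNbhd p ⟦ v ⟧ → u ⊆ᶜ ⟦ v ⟧)

-- If a family 𝒖 never contains both X and ∁ X, every neighbourhood v ⊆ 𝒖 of G
-- contains all of 𝒖: for Y ∈ 𝒖 ∖ v also ∁ Y ∉ v, so G = Y ⊔ ∁ Y would be a
-- disjoint union of non-members of v. A clopen neighbourhood v ⊆ 𝒖 would thus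
-- contain 𝒖 and be closed under disjoint unions, hence contain both Q₀ ∪ Q₁ and
-- its complement Q₂. That the particular 𝒖 below is a regular open neighbourhood
-- of G is a finite check: φ of a Boolean family is decided by any fixed point of
-- "X is a member, or X splits off a member Y with X ─ Y accepted" (unique, as Y
-- is nonempty), and such a fixed point is computed by iteration.
module Submission where

open import Defs
open import Data.Bool using (Bool; true; false; not; if_then_else_)
open import Data.Bool.ListAction using (any)
open import Data.Bool.Properties using () renaming (_≟_ to _≟ᵇ_)
open import Data.Nat using (ℕ; zero; suc; _≤ᵇ_; _≡ᵇ_)
open import Data.Fin using (toℕ; zero; suc)
open import Data.Fin.Subset
  using (Subset; ⊤; ⊥; ∁; _∪_; _∩_; _─_; ⋃; Nonempty; Empty; _∈_; _⊆_; _⊂_; ∣_∣; inside; outside)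
open import Data.Fin.Subset.Properties
  using ( nonempty?; anySubset?; drop-∷-⊆; s⊆s; out⊆; drop-∷-Empty; Empty-unique; ∉⊥
        ; x∈p∩q⁺; x∈p∩q⁻; x∈p∪q⁺; x∈p∪q⁻; ∈⊤; x∉p⇒x∈∁p; x∈∁p⇒x∉p; ⊆-antisym
        ; p⊆p∪q; p∪∁p≡⊤; ∪-identityʳ; p∩q≢∅⇒p─q⊂p)
open import Data.Fin.Subset.Induction using (⊂-wellFounded; Acc; acc)
open import Data.Vec using ([]; _∷_; here; there)
import Data.Vec as Vec
open import Data.Vec.Properties using (≡-dec)
open import Data.List using (List; []; _∷_; map)
open import Data.List.Relation.Unary.All using (All; []; _∷_)
open import Data.List.Relation.Unary.AllPairs using (AllPairs; []; _∷_)
open import Data.Product using (Σ; _×_; _,_; ∃; proj₂)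
open import Data.Sum using (_⊎_; inj₁; inj₂; [_,_]′)
open import Function using (_∘_; id; const)
open import Function.Bundles using (_⇔_; mk⇔; Equivalence)
open import Relation.Nullary using (¬_; Dec; yes; no; does; contradiction)
open import Relation.Nullary.Decidable
  using (_×-dec_; _⊎-dec_; _→-dec_; ¬?; map′; decidable-stable; toWitness)
open import Relation.Unary using (Decidable)
open import Relation.Binary.PropositionalEquality using (_≡_; _≢_; refl; sym; trans; cong; subst; module ≡-Reasoning)

open Equivalence using (to; from)

private
  variable
    n : ℕ
    p q r X Y Z : Subset n
    x y z : Fam n
    b t : Subset n → Bool

p⊆q⇒p∪[q─p]≡q : p ⊆ q → p ∪ (q ─ p) ≡ q
p⊆q⇒p∪[q─p]≡q {p = []}          {q = []}          _   = refl
p⊆q⇒p∪[q─p]≡q {p = inside ∷ p}  {q = inside ∷ q}  p⊆q =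
  cong (inside ∷_) (p⊆q⇒p∪[q─p]≡q (drop-∷-⊆ p⊆q))
p⊆q⇒p∪[q─p]≡q {p = inside ∷ p}  {q = outside ∷ q} p⊆q with p⊆q here
... | ()
p⊆q⇒p∪[q─p]≡q {p = outside ∷ p} {q = s ∷ q}       p⊆q =
  cong (s ∷_) (p⊆q⇒p∪[q─p]≡q (drop-∷-⊆ p⊆q))

Disjoint⇒[p∪q]─p≡q : Disjoint p q → (p ∪ q) ─ p ≡ q
Disjoint⇒[p∪q]─p≡q {p = []}          {q = []}          _ = refl
Disjoint⇒[p∪q]─p≡q {p = inside ∷ p}  {q = inside ∷ q}  d = contradiction (zero , here) d
Disjoint⇒[p∪q]─p≡q {p = inside ∷ p}  {q = outside ∷ q} d =
  cong (outside ∷_) (Disjoint⇒[p∪q]─p≡q (drop-∷-Empty d))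
Disjoint⇒[p∪q]─p≡q {p = outside ∷ p} {q = s ∷ q}       d =
  cong (s ∷_) (Disjoint⇒[p∪q]─p≡q (drop-∷-Empty d))

Disjoint-─ : ∀ (p q : Subset n) → Disjoint p (q ─ p)
Disjoint-─ (inside ∷ p)  (_ ∷ q) (zero , ())
Disjoint-─ (outside ∷ p) (_ ∷ q) (zero , ())
Disjoint-─ (_ ∷ p)       (_ ∷ q) (suc i , there i∈) = Disjoint-─ p q (i , i∈)

Disjoint-∁ : ∀ (p : Subset n) → Disjoint p (∁ p)
Disjoint-∁ (inside ∷ p)  (zero , ())
Disjoint-∁ (outside ∷ p) (zero , ())
Disjoint-∁ (_ ∷ p)       (suc i , there i∈) = Disjoint-∁ p (i , i∈)

Disjoint-⊥ : Disjoint p ⊥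
Disjoint-⊥ {p = p} (i , i∈) = ∉⊥ (proj₂ (x∈p∩q⁻ p ⊥ i∈))

Disjoint-∪ : Disjoint p q → Disjoint p r → Disjoint p (q ∪ r)
Disjoint-∪ {p = p} {q} {r} d₁ d₂ (i , i∈) with x∈p∩q⁻ p (q ∪ r) i∈
... | i∈p , i∈q∪r with x∈p∪q⁻ q r i∈q∪r
...   | inj₁ i∈q = d₁ (i , x∈p∩q⁺ (i∈p , i∈q))
...   | inj₂ i∈r = d₂ (i , x∈p∩q⁺ (i∈p , i∈r))

Disjoint-antimonoʳ : q ⊆ r → Disjoint p r → Disjoint p q
Disjoint-antimonoʳ {q = q} {p = p} q⊆r d (i , i∈) with x∈p∩q⁻ p q i∈
... | i∈p , i∈q = d (i , x∈p∩q⁺ (i∈p , q⊆r i∈q))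

Disjoint-⋃⁺ : ∀ {L : List (Subset n)} → All (Disjoint p) L → Disjoint p (⋃ L)
Disjoint-⋃⁺ []       = Disjoint-⊥
Disjoint-⋃⁺ (d ∷ ds) = Disjoint-∪ d (Disjoint-⋃⁺ ds)

Disjoint-⋃⁻ : ∀ (L : List (Subset n)) → Disjoint p (⋃ L) → All (Disjoint p) L
Disjoint-⋃⁻ []      _ = []
Disjoint-⋃⁻ (q ∷ L) d =
  Disjoint-antimonoʳ (p⊆p∪q (⋃ L)) d ∷ Disjoint-⋃⁻ L (Disjoint-antimonoʳ (x∈p∪q⁺ ∘ inj₂) d)

Empty-∁⇒≡⊤ : Empty (∁ p) → p ≡ ⊤
Empty-∁⇒≡⊤ {p = p} ∅ = begin
  p        ≡⟨ sym (∪-identityʳ p) ⟩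
  p ∪ ⊥    ≡⟨ cong (p ∪_) (sym (Empty-unique ∅)) ⟩
  p ∪ ∁ p  ≡⟨ p∪∁p≡⊤ p ⟩
  ⊤        ∎
  where open ≡-Reasoning

partition⇒≡∁ : Disjoint p r → Disjoint q r → p ∪ (q ∪ r) ≡ ⊤ → r ≡ ∁ (p ∪ q)
partition⇒≡∁ {p = p} {r = r} {q = q} p∩r=∅ q∩r=∅ cover = ⊆-antisym r⊆∁[p∪q] ∁[p∪q]⊆r
  where
  r⊆∁[p∪q] : r ⊆ ∁ (p ∪ q)
  r⊆∁[p∪q] i∈r = x∉p⇒x∈∁p λ i∈p∪q →
    [ (λ i∈p → p∩r=∅ (_ , x∈p∩q⁺ (i∈p , i∈r)))
    , (λ i∈q → q∩r=∅ (_ , x∈p∩q⁺ (i∈q , i∈r))) ]′ (x∈p∪q⁻ p q i∈p∪q)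
  ∁[p∪q]⊆r : ∁ (p ∪ q) ⊆ r
  ∁[p∪q]⊆r i∈∁[p∪q] with x∈p∪q⁻ p (q ∪ r) (subst (_ ∈_) (sym cover) ∈⊤)
  ... | inj₁ i∈p = contradiction (x∈p∪q⁺ (inj₁ i∈p)) (x∈∁p⇒x∉p i∈∁[p∪q])
  ... | inj₂ i∈q∪r with x∈p∪q⁻ q r i∈q∪r
  ...   | inj₁ i∈q = contradiction (x∈p∪q⁺ (inj₂ i∈q)) (x∈∁p⇒x∉p i∈∁[p∪q])
  ...   | inj₂ i∈r = i∈r

φ-singleton : X ∈ᶜ x → φ x X
φ-singleton {X = X} X∈x = X ∷ [] , (λ ()) , X∈x ∷ [] , [] ∷ [] , ∪-identityʳ X

φ-∪ : Y ∈ᶜ x → Disjoint Y Z → φ x Z → φ x (Y ∪ Z)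
φ-∪ Y∈x d (L , _ , L⊆x , disjoint , refl) =
  _ ∷ L , (λ ()) , Y∈x ∷ L⊆x , Disjoint-⋃⁻ L d ∷ disjoint , refl

φ-induction : (P : Subset n → Set)
  → (∀ Y → Y ∈ᶜ x → P Y)
  → (∀ Y Z → Y ∈ᶜ x → Disjoint Y Z → P Z → P (Y ∪ Z))
  → ∀ X → φ x X → P X
φ-induction {x = x} P base step X (L , L≢[] , L⊆x , disjoint , refl) = go L L≢[] L⊆x disjoint
  where
  go : ∀ L → ¬ L ≡ [] → All (_∈ᶜ x) L → AllPairs Disjoint L → P (⋃ L)
  go []                L≢[] _           _        = contradiction refl L≢[]
  go (Y ∷ [])          _    (Y∈x ∷ [])  _        = subst P (sym (∪-identityʳ Y)) (base Y Y∈x)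
  go (Y ∷ L@(_ ∷ _))   _    (Y∈x ∷ L⊆x) (d ∷ ds) =
    step Y (⋃ L) Y∈x (Disjoint-⋃⁺ d) (go L (λ ()) L⊆x ds)

φ-mono : x ⊆ᶜ y → ∀ X → φ x X → φ y X
φ-mono {y = y} x⊆y = φ-induction (φ y)
  (λ Y Y∈x → φ-singleton (x⊆y Y Y∈x))
  (λ Y Z Y∈x d φyZ → φ-∪ (x⊆y Y Y∈x) d φyZ)

compl-antimono : x ⊆ᶜ y → compl y ⊆ᶜ compl x
compl-antimono x⊆y X (X≠∅ , X∉y) = X≠∅ , λ X∈x → X∉y (x⊆y X X∈x)

compl-cong : x ≐ᶜ y → compl x ≐ᶜ compl y
compl-cong (x⊆y , y⊆x) = compl-antimono y⊆x , compl-antimono x⊆y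

φ-cong : x ≐ᶜ y → φ x ≐ᶜ φ y
φ-cong (x⊆y , y⊆x) = (λ X (X≠∅ , φxX) → X≠∅ , φ-mono x⊆y X φxX)
                   , (λ X (X≠∅ , φyX) → X≠∅ , φ-mono y⊆x X φyX)

φ̌-cong : x ≐ᶜ y → φ̌ x ≐ᶜ φ̌ y
φ̌-cong = compl-cong ∘ φ-cong ∘ compl-cong

≐ᶜ-sym : x ≐ᶜ y → y ≐ᶜ x
≐ᶜ-sym (x⊆y , y⊆x) = y⊆x , x⊆y

≐ᶜ-trans : x ≐ᶜ y → y ≐ᶜ z → x ≐ᶜ z
≐ᶜ-trans (x⊆y , y⊆x) (y⊆z , z⊆y) = (λ X → y⊆z X ∘ x⊆y X) , (λ X → y⊆x X ∘ z⊆y X)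

not≡true⇔≢true : ∀ {c} → not c ≡ true ⇔ c ≢ true
not≡true⇔≢true {true}  = mk⇔ (λ ()) (λ c≢true → contradiction refl c≢true)
not≡true⇔≢true {false} = mk⇔ (λ _ ()) (const refl)

-- Not `not ∘ b`: _∘_ is inlined, so b would be re-evaluated at every argument.
complᵇ : (Subset n → Bool) → Subset n → Bool
complᵇ b X = not (b X)

compl⟦⟧≐ᶜ⟦complᵇ⟧ : ∀ (b : Subset n → Bool) → compl ⟦ b ⟧ ≐ᶜ ⟦ complᵇ b ⟧
compl⟦⟧≐ᶜ⟦complᵇ⟧ b =
    (λ X (X≠∅ , X∉b) → X≠∅ , from not≡true⇔≢true (λ bX → X∉b (X≠∅ , bX)))
  , (λ X (X≠∅ , ¬bX) → X≠∅ , λ (_ , bX) → to not≡true⇔≢true ¬bX bX)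

infix 3 _⇔?_
_⇔?_ : ∀ {A B : Set} → Dec A → Dec B → Dec (A ⇔ B)
A? ⇔? B? = map′ (λ (f , g) → mk⇔ f g) (λ A⇔B → to A⇔B , from A⇔B) ((A? →-dec B?) ×-dec (B? →-dec A?))

allSubset? : ∀ {P : Subset n → Set} → Decidable P → Dec (∀ X → P X)
allSubset? P? = map′ (λ ¬∃¬P X → decidable-stable (P? X) (λ ¬PX → ¬∃¬P (X , ¬PX)))
                     (λ ∀P (X , ¬PX) → ¬PX (∀P X))
                     (¬? (anySubset? (¬? ∘ P?)))

∃⊆ : Subset n → (Subset n → Set) → Set
∃⊆ X P = ∃ λ Y → Y ⊆ X × P Y

anySubsetOf? : ∀ {P : Subset n → Set} (X : Subset n) → Decidable P → Dec (∃⊆ X P)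
anySubsetOf? [] P? = map′ (λ P[] → [] , id , P[]) (λ { ([] , _ , P[]) → P[] }) (P? [])
anySubsetOf? {P = P} (inside ∷ X) P? =
  map′ join split (anySubsetOf? X (P? ∘ (inside ∷_)) ⊎-dec anySubsetOf? X (P? ∘ (outside ∷_)))
  where
  join : ∃⊆ X (P ∘ (inside ∷_)) ⊎ ∃⊆ X (P ∘ (outside ∷_)) → ∃⊆ (inside ∷ X) P
  join (inj₁ (Y , Y⊆X , PY)) = inside ∷ Y , s⊆s Y⊆X , PY
  join (inj₂ (Y , Y⊆X , PY)) = outside ∷ Y , out⊆ Y⊆X , PY
  split : ∃⊆ (inside ∷ X) P → ∃⊆ X (P ∘ (inside ∷_)) ⊎ ∃⊆ X (P ∘ (outside ∷_))
  split (inside ∷ Y  , Y⊆ , PY) = inj₁ (Y , drop-∷-⊆ Y⊆ , PY)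
  split (outside ∷ Y , Y⊆ , PY) = inj₂ (Y , drop-∷-⊆ Y⊆ , PY)
anySubsetOf? {P = P} (outside ∷ X) P? = map′ join split (anySubsetOf? X (P? ∘ (outside ∷_)))
  where
  join : ∃⊆ X (P ∘ (outside ∷_)) → ∃⊆ (outside ∷ X) P
  join (Y , Y⊆X , PY) = outside ∷ Y , out⊆ Y⊆X , PY
  split : ∃⊆ (outside ∷ X) P → ∃⊆ X (P ∘ (outside ∷_))
  split (inside ∷ Y  , Y⊆ , _)  with Y⊆ here
  ... | ()
  split (outside ∷ Y , Y⊆ , PY) = Y , drop-∷-⊆ Y⊆ , PY

infix 4 _∈ᶜ?_ _⊆ᶜ?_ _≐ᶜ?_
_∈ᶜ?_ : ∀ (X : Subset n) (b : Subset n → Bool) → Dec (X ∈ᶜ ⟦ b ⟧)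
X ∈ᶜ? b = nonempty? X ×-dec (b X ≟ᵇ true)

_⊆ᶜ?_ : ∀ (b c : Subset n → Bool) → Dec (⟦ b ⟧ ⊆ᶜ ⟦ c ⟧)
b ⊆ᶜ? c = allSubset? λ X → X ∈ᶜ? b →-dec X ∈ᶜ? c

_≐ᶜ?_ : ∀ (b c : Subset n → Bool) → Dec (⟦ b ⟧ ≐ᶜ ⟦ c ⟧)
b ≐ᶜ? c = b ⊆ᶜ? c ×-dec c ⊆ᶜ? b

Splits : (b t : Subset n → Bool) → Subset n → Set
Splits b t X = X ∈ᶜ ⟦ b ⟧ ⊎ ∃⊆ X λ Y → Y ∈ᶜ ⟦ b ⟧ × t (X ─ Y) ≡ true

splits? : ∀ (b t : Subset n → Bool) → Decidable (Splits b t)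
splits? b t X = X ∈ᶜ? b ⊎-dec anySubsetOf? X λ Y → Y ∈ᶜ? b ×-dec t (X ─ Y) ≟ᵇ true

IsSplitFixpoint : (b t : Subset n → Bool) → Set
IsSplitFixpoint b t = ∀ X → t X ≡ true ⇔ Splits b t X

isSplitFixpoint? : ∀ (b t : Subset n → Bool) → Dec (IsSplitFixpoint b t)
isSplitFixpoint? b t = allSubset? λ X → (t X ≟ᵇ true) ⇔? splits? b t X

split-fixpoint-sound : IsSplitFixpoint b t → ∀ X → t X ≡ true → φ ⟦ b ⟧ X
split-fixpoint-sound {b = b} {t = t} fix X = go X (⊂-wellFounded X)
  where
  go : ∀ X → Acc _⊂_ X → t X ≡ true → φ ⟦ b ⟧ X
  go X (acc smaller) tX with to (fix X) tX
  ... | inj₁ X∈b = φ-singleton X∈b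
  ... | inj₂ (Y , Y⊆X , Y∈b@((i , i∈Y) , _) , tX─Y) =
    subst (φ ⟦ b ⟧) (p⊆q⇒p∪[q─p]≡q Y⊆X)
      (φ-∪ Y∈b (Disjoint-─ Y X) (go (X ─ Y) (smaller (p∩q≢∅⇒p─q⊂p X Y X∩Y≠∅)) tX─Y))
    where
    X∩Y≠∅ : Nonempty (X ∩ Y)
    X∩Y≠∅ = i , x∈p∩q⁺ (Y⊆X i∈Y , i∈Y)

split-fixpoint-complete : IsSplitFixpoint b t → ∀ X → φ ⟦ b ⟧ X → t X ≡ true
split-fixpoint-complete {t = t} fix = φ-induction (λ X → t X ≡ true)
  (λ Y Y∈b → from (fix Y) (inj₁ Y∈b))
  (λ Y Z Y∈b Y∩Z=∅ tZ → from (fix (Y ∪ Z))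
     (inj₂ (Y , p⊆p∪q Z , Y∈b , subst (λ W → t W ≡ true) (sym (Disjoint⇒[p∪q]─p≡q Y∩Z=∅)) tZ)))

split-fixpoint⇒φ≐ᶜ : IsSplitFixpoint b t → φ ⟦ b ⟧ ≐ᶜ ⟦ t ⟧
split-fixpoint⇒φ≐ᶜ fix = (λ X (X≠∅ , φX) → X≠∅ , split-fixpoint-complete fix X φX)
                       , (λ X (X≠∅ , tX) → X≠∅ , split-fixpoint-sound fix X tX)

split-fixpoint⇒φ̌≐ᶜ : IsSplitFixpoint (complᵇ b) t → φ̌ ⟦ b ⟧ ≐ᶜ ⟦ complᵇ t ⟧
split-fixpoint⇒φ̌≐ᶜ {b = b} {t = t} fix =
  ≐ᶜ-trans (compl-cong (≐ᶜ-trans (φ-cong (compl⟦⟧≐ᶜ⟦complᵇ⟧ b)) (split-fixpoint⇒φ≐ᶜ fix)))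
           (compl⟦⟧≐ᶜ⟦complᵇ⟧ t)

-- A table memoises a Boolean family, so that a computed family passed as an
-- argument is evaluated only once during a proof by computation.
data Table : ℕ → Set where
  leaf : Bool → Table 0
  node : Table n → Table n → Table (suc n)

lookup : Table n → Subset n → Bool
lookup (leaf c)   []          = c
lookup (node l r) (inside ∷ X)  = lookup l X
lookup (node l r) (outside ∷ X) = lookup r X

tabulate : (Subset n → Bool) → Table n
tabulate {n = zero}  f = leaf (f [])
tabulate {n = suc n} f = node (tabulate (f ∘ (inside ∷_))) (tabulate (f ∘ (outside ∷_)))

-- Kleene iteration of the splitting operator from ∅; n + 1 rounds suffice since a
-- decomposition has at most n pieces. This is not proved: where φᵇ is used, the
-- fixed-point property is checked. Passing the previous round to `step` as an
-- argument makes it shared instead of recomputed for every X.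
φᵇ : (Subset n → Bool) → Subset n → Bool
φᵇ {n = n} b = lookup (iterate (suc n))
  where
  iterate : ℕ → Table n
  iterate zero    = tabulate (const false)
  iterate (suc k) = step (iterate k)
    where
    step : Table n → Table n
    step t = tabulate λ X → does (splits? b (lookup t) X)

AvoidsComplements : Fam n → Set
AvoidsComplements x = ∀ X → X ∈ᶜ x → ∁ X ∉ᶜ x

MemberPartition : Fam n → Subset n → Subset n → Subset n → Set
MemberPartition x Q₀ Q₁ Q₂ =
  Q₀ ∈ᶜ x × Q₁ ∈ᶜ x × Q₂ ∈ᶜ x
  × Disjoint Q₀ Q₁ × Disjoint Q₀ Q₂ × Disjoint Q₁ Q₂
  × Q₀ ∪ (Q₁ ∪ Q₂) ≡ ⊤

⊤-nbhd⇒∁∈ : ∀ {v : Subset n → Bool}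
  → IsNbhd ⊤ ⟦ v ⟧ → Nonempty Y → v Y ≡ false → ∁ Y ∈ᶜ ⟦ v ⟧
⊤-nbhd⇒∁∈ {Y = Y} {v = v} (⊤≠∅ , ⊤∉φ∁v) Y≠∅ vY≡false =
  decidable-stable (∁ Y ∈ᶜ? v) λ ∁Y∉v → ⊤∉φ∁v (⊤≠∅ , ⊤∈φ∁v ∁Y∉v)
  where
  Y∉v : Y ∈ᶜ compl ⟦ v ⟧
  Y∉v = Y≠∅ , λ (_ , vY) → contradiction (trans (sym vY≡false) vY) λ ()
  ⊤∈φ∁v : ∁ Y ∉ᶜ ⟦ v ⟧ → φ (compl ⟦ v ⟧) ⊤
  ⊤∈φ∁v ∁Y∉v with nonempty? (∁ Y)
  ... | yes ∁Y≠∅ = subst (φ _) (p∪∁p≡⊤ Y) (φ-∪ Y∉v (Disjoint-∁ Y) (φ-singleton (∁Y≠∅ , ∁Y∉v)))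
  ... | no  ∁Y=∅ = subst (φ _) (Empty-∁⇒≡⊤ ∁Y=∅) (φ-singleton Y∉v)

avoids-∁⇒min-nbhd : AvoidsComplements x
  → (v : Subset n → Bool) → ⟦ v ⟧ ⊆ᶜ x → IsNbhd ⊤ ⟦ v ⟧ → x ⊆ᶜ ⟦ v ⟧
avoids-∁⇒min-nbhd avoids v v⊆x nbhd Y Y∈x@(Y≠∅ , _) with v Y in vY
... | true  = Y≠∅ , refl
... | false = contradiction (v⊆x _ (⊤-nbhd⇒∁∈ nbhd Y≠∅ vY)) (avoids Y Y∈x)

avoids-∁⇒no-clopen-nbhd : ∀ {Q₀ Q₁ Q₂} → AvoidsComplements x → MemberPartition x Q₀ Q₁ Q₂
  → (v : Subset n → Bool) → ⟦ v ⟧ ⊆ᶜ x → IsClopen ⟦ v ⟧ → ¬ IsNbhd ⊤ ⟦ v ⟧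
avoids-∁⇒no-clopen-nbhd {x = x} {Q₀ = Q₀} {Q₁ = Q₁} avoids
  (Q₀∈x@((i , i∈Q₀) , _) , Q₁∈x , Q₂∈x , Q₀∩Q₁=∅ , Q₀∩Q₂=∅ , Q₁∩Q₂=∅ , cover)
  v v⊆x (_ , φv⊆v , _) nbhd =
  avoids (Q₀ ∪ Q₁) (v⊆x _ (φv⊆v _ Q₀∪Q₁∈φv))
    (subst (_∈ᶜ x) (partition⇒≡∁ Q₀∩Q₂=∅ Q₁∩Q₂=∅ cover) Q₂∈x)
  where
  x⊆v : x ⊆ᶜ ⟦ v ⟧
  x⊆v = avoids-∁⇒min-nbhd avoids v v⊆x nbhd
  Q₀∪Q₁∈φv : (Q₀ ∪ Q₁) ∈ᶜ φ ⟦ v ⟧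
  Q₀∪Q₁∈φv =
    (i , x∈p∪q⁺ (inj₁ i∈Q₀)) , φ-∪ (x⊆v Q₀ Q₀∈x) Q₀∩Q₁=∅ (φ-singleton (x⊆v Q₁ Q₁∈x))

elements : List ℕ → Subset n
elements ns = Vec.tabulate λ i → any (toℕ i ≡ᵇ_) ns

-- 𝒖 contains exactly one of X and ∁ X, so it is determined by its members with
-- at most three elements, which are listed here.
small : List (Subset 7)
small = map elements
  ( (1 ∷ []) ∷ (2 ∷ []) ∷ (4 ∷ []) ∷ (6 ∷ [])
  ∷ (0 ∷ 1 ∷ []) ∷ (0 ∷ 6 ∷ []) ∷ (1 ∷ 2 ∷ []) ∷ (1 ∷ 4 ∷ []) ∷ (1 ∷ 6 ∷ [])
  ∷ (2 ∷ 3 ∷ []) ∷ (2 ∷ 4 ∷ []) ∷ (2 ∷ 6 ∷ []) ∷ (3 ∷ 4 ∷ []) ∷ (4 ∷ 6 ∷ [])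
  ∷ (0 ∷ 1 ∷ 2 ∷ []) ∷ (0 ∷ 1 ∷ 4 ∷ []) ∷ (0 ∷ 1 ∷ 6 ∷ []) ∷ (0 ∷ 2 ∷ 4 ∷ [])
  ∷ (0 ∷ 2 ∷ 6 ∷ []) ∷ (0 ∷ 4 ∷ 6 ∷ []) ∷ (1 ∷ 2 ∷ 3 ∷ []) ∷ (1 ∷ 2 ∷ 4 ∷ [])
  ∷ (1 ∷ 2 ∷ 5 ∷ []) ∷ (1 ∷ 2 ∷ 6 ∷ []) ∷ (1 ∷ 3 ∷ 4 ∷ []) ∷ (1 ∷ 3 ∷ 6 ∷ [])
  ∷ (1 ∷ 4 ∷ 5 ∷ []) ∷ (1 ∷ 4 ∷ 6 ∷ []) ∷ (2 ∷ 3 ∷ 4 ∷ []) ∷ (2 ∷ 3 ∷ 6 ∷ [])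
  ∷ (2 ∷ 4 ∷ 6 ∷ []) ∷ (2 ∷ 5 ∷ 6 ∷ []) ∷ (3 ∷ 4 ∷ 6 ∷ []) ∷ (4 ∷ 5 ∷ 6 ∷ [])
  ∷ [])

u : Subset 7 → Bool
u = lookup (tabulate λ X → if ∣ X ∣ ≤ᵇ 3 then listed X else not (listed (∁ X)))
  where
  listed : Subset 7 → Bool
  listed X = any (λ Y → does (≡-dec _≟ᵇ_ X Y)) small

u-φᵇ-fixpoint : IsSplitFixpoint u (φᵇ u)
u-φᵇ-fixpoint = toWitness {a? = isSplitFixpoint? u (φᵇ u)} _

∁u-φᵇ-fixpoint : IsSplitFixpoint (complᵇ u) (φᵇ (complᵇ u))
∁u-φᵇ-fixpoint = toWitness {a? = isSplitFixpoint? (complᵇ u) (φᵇ (complᵇ u))} _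

∁φu-φᵇ-fixpoint : IsSplitFixpoint (complᵇ (φᵇ u)) (φᵇ (complᵇ (φᵇ u)))
∁φu-φᵇ-fixpoint = toWitness {a? = isSplitFixpoint? (complᵇ (φᵇ u)) (φᵇ (complᵇ (φᵇ u)))} _

u≐ᶜ∁φ∁φu : ⟦ u ⟧ ≐ᶜ ⟦ complᵇ (φᵇ (complᵇ (φᵇ u))) ⟧
u≐ᶜ∁φ∁φu = toWitness {a? = u ≐ᶜ? (complᵇ (φᵇ (complᵇ (φᵇ u))))} _

u-self-dual : ∀ X → X ∈ᶜ ⟦ u ⟧ ⇔ ∁ X ∉ᶜ ⟦ u ⟧
u-self-dual = toWitness {a? = allSubset? λ X → X ∈ᶜ? u ⇔? ¬? (∁ X ∈ᶜ? u)} _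

u-nbhd : IsNbhd ⊤ ⟦ u ⟧
u-nbhd = proj₂ (split-fixpoint⇒φ̌≐ᶜ ∁u-φᵇ-fixpoint) ⊤ ((zero , here) , refl)

u-regular : IsRegularOpen ⟦ u ⟧
u-regular = ≐ᶜ-trans u≐ᶜ∁φ∁φu (≐ᶜ-sym (≐ᶜ-trans φ̌φu≐ᶜφ̌⟦φᵇu⟧ (split-fixpoint⇒φ̌≐ᶜ ∁φu-φᵇ-fixpoint)))
  where
  φ̌φu≐ᶜφ̌⟦φᵇu⟧ : φ̌ (φ ⟦ u ⟧) ≐ᶜ φ̌ ⟦ φᵇ u ⟧
  φ̌φu≐ᶜφ̌⟦φᵇu⟧ = φ̌-cong (split-fixpoint⇒φ≐ᶜ u-φᵇ-fixpoint)

Q₀ Q₁ Q₂ : Subset 7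
Q₀ = elements (0 ∷ 1 ∷ [])
Q₁ = elements (2 ∷ 3 ∷ [])
Q₂ = elements (4 ∷ 5 ∷ 6 ∷ [])

Q-partition : MemberPartition ⟦ u ⟧ Q₀ Q₁ Q₂
Q-partition = toWitness {a? = Q₀ ∈ᶜ? u ×-dec Q₁ ∈ᶜ? u ×-dec Q₂ ∈ᶜ? u
                              ×-dec disjoint? Q₀ Q₁ ×-dec disjoint? Q₀ Q₂ ×-dec disjoint? Q₁ Q₂
                              ×-dec ≡-dec _≟ᵇ_ (Q₀ ∪ (Q₁ ∪ Q₂)) ⊤} _
  where
  disjoint? : ∀ (p q : Subset 7) → Dec (Disjoint p q)
  disjoint? p q = ¬? (nonempty? (p ∩ q))

theorem18p1 :
    Σ (Subset 7 → Bool) λ u →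
      IsMinNbhd ⊤ ⟦ u ⟧
      × IsRegularOpen ⟦ u ⟧
      × ((X : Subset 7) → (X ∈ᶜ ⟦ u ⟧) ⇔ (∁ X ∉ᶜ ⟦ u ⟧))
      × Σ (Subset 7) (λ Q₀ → Σ (Subset 7) λ Q₁ → Σ (Subset 7) λ Q₂ →
          Q₀ ∈ᶜ ⟦ u ⟧ × Q₁ ∈ᶜ ⟦ u ⟧ × Q₂ ∈ᶜ ⟦ u ⟧
          × Disjoint Q₀ Q₁ × Disjoint Q₀ Q₂ × Disjoint Q₁ Q₂
          × Q₀ ∪ (Q₁ ∪ Q₂) ≡ ⊤)
      × ((v : Subset 7 → Bool) → ⟦ v ⟧ ⊆ᶜ ⟦ u ⟧ → IsClopen ⟦ v ⟧
          → ¬ IsNbhd ⊤ ⟦ v ⟧)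
theorem18p1 =
  u , (u-nbhd , avoids-∁⇒min-nbhd avoids) , u-regular , u-self-dual
    , (Q₀ , Q₁ , Q₂ , Q-partition) , avoids-∁⇒no-clopen-nbhd avoids Q-partition
  where
  avoids : AvoidsComplements ⟦ u ⟧
  avoids X = to (u-self-dual X)
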